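{- Let $n=p_1p_2p_3$ ($p_i$ distinct primes), $\gcd(n,6)=1$, $n>1000$, $G$ cyclic of order $n$, $\mathrm{ord}(g)=n$. Let $a,b,c$ be integers with $1+c=a+b$ and $1<c<\frac n2<n-b\le n-a<n-1$, such that $S=(g)\cdot(cg)\cdot((n-b)g)\cdot((n-a)g)$ is a reduced minimal zero-sum sequence and one of (A2), (A3), (A4) below holds. Let $s=\lfloor b/a\rfloor$. Suppose $s\ge2$ and for every integer $t\in[0,\lfloor s/2\rfloor-1]$ the interval $[\frac{(2s-2t-1)n}{2b},\frac{(s-t)n}{b}]$ contains no integer coprime to $n$. Then for every integer $t\in[0,\lfloor s/2\rfloor-1]$ the interval $[\frac{(2s-2t-1)n}{2b},\frac{(s-t)n}{b}]$ contains at most $3$ integers. Hence $\frac{n}{2b}<4$.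
   Context: Minimal zero-sum sequence: a finite unordered sequence of elements of $G$ whose terms sum to $0$ and no proper nonempty subsequence of which sums to $0$. $S$ is reduced if for every prime $p\mid n$ the sequence $(pg)\cdot(pcg)\cdot(p(n-b)g)\cdot(p(n-a)g)$ is not minimal zero-sum. Conditions (for a suitable labeling of the primes): (A2) $\{\gcd(c,n),\gcd(b,n),\gcd(a,n)\}=\{p_1,p_2,p_1p_2\}$; (A3) $\gcd(c+1,n)=p_1p_2$, $\gcd(b-1,n)=p_1p_3$, $\gcd(a-1,n)=p_2p_3$; (A4) $\gcd(c,n)=p_1p_2$, $\gcd(b,n)=p_1p_3$, $\gcd(a,n)=p_2p_3$. -}

module Defs where

open import Data.Nat using (ℕ; zero; suc; _+_; _*_; _∸_; _≤_; _<_; NonZero)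
open import Data.Nat.DivMod using (_%_; _/_)
open import Data.Nat.GCD using (gcd)
open import Data.Nat.Primality using (Prime)
open import Data.Nat.Divisibility using (_∣_)
open import Data.Nat.Coprimality using (Coprime)
open import Data.List using (List; []; _∷_; length; map)
open import Data.Nat.ListAction using (sum)
open import Data.List.Membership.Propositional using (_∈_)
open import Data.List.Relation.Binary.Sublist.Propositional using (_⊆_)
open import Data.List.Relation.Binary.Permutation.Propositional using (_↭_)
open import Data.List.Relation.Unary.All using (All)
open import Data.List.Relation.Unary.Unique.Propositional using (Unique)
open import Data.Product using (_×_; Σ; ∃; ∃-syntax)
open import Data.Sum using (_⊎_)
open import Relation.Nullary using (¬_)
open import Relation.Binary.PropositionalEquality using (_≡_; _≢_)

-- The cyclic group G of order n is modelled as ℤ/nℤ: an element is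
-- represented by a natural number, two naturals being the same element
-- iff they are congruent mod n.  Multiples kg are k * g.

IsZero : (n : ℕ) → .{{NonZero n}} → ℕ → Set
IsZero n x = x % n ≡ 0

HasOrder : (n : ℕ) → .{{NonZero n}} → (g k : ℕ) → Set
HasOrder n g k =
  0 < k × IsZero n (k * g) × (∀ j → 0 < j → IsZero n (j * g) → k ≤ j)

-- A (finite, unordered) sequence over ℤ/nℤ, given by a list of
-- representatives.  Subsequences (sub-multisets) are exactly the
-- sublists up to order, so it suffices to range over sublists.
IsMinimalZeroSum : (n : ℕ) → .{{NonZero n}} → List ℕ → Set
IsMinimalZeroSum n xs =
  0 < length xs × IsZero n (sum xs) ×
  (∀ ys → ys ⊆ xs → 0 < length ys → length ys < length xs → ¬ IsZero n (sum ys))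

seqS : (n g a b c : ℕ) → List ℕ
seqS n g a b c = g ∷ c * g ∷ (n ∸ b) * g ∷ (n ∸ a) * g ∷ []

IsReduced : (n : ℕ) → .{{NonZero n}} → (g a b c : ℕ) → Set
IsReduced n g a b c =
  ∀ p → Prime p → p ∣ n →
    ¬ IsMinimalZeroSum n (map (p *_) (seqS n g a b c))

Relabel : (p₁ p₂ p₃ q₁ q₂ q₃ : ℕ) → Set
Relabel p₁ p₂ p₃ q₁ q₂ q₃ = (q₁ ∷ q₂ ∷ q₃ ∷ []) ↭ (p₁ ∷ p₂ ∷ p₃ ∷ [])

SetEq3 : (x y z u v w : ℕ) → Set
SetEq3 x y z u v w =
  All (_∈ (u ∷ v ∷ w ∷ [])) (x ∷ y ∷ z ∷ []) ×
  All (_∈ (x ∷ y ∷ z ∷ [])) (u ∷ v ∷ w ∷ [])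

CondA2 : (n a b c q₁ q₂ q₃ : ℕ) → Set
CondA2 n a b c q₁ q₂ q₃ =
  SetEq3 (gcd c n) (gcd b n) (gcd a n) q₁ q₂ (q₁ * q₂)

CondA3 : (n a b c q₁ q₂ q₃ : ℕ) → Set
CondA3 n a b c q₁ q₂ q₃ =
  gcd (c + 1) n ≡ q₁ * q₂ × gcd (b ∸ 1) n ≡ q₁ * q₃ × gcd (a ∸ 1) n ≡ q₂ * q₃

CondA4 : (n a b c q₁ q₂ q₃ : ℕ) → Set
CondA4 n a b c q₁ q₂ q₃ =
  gcd c n ≡ q₁ * q₂ × gcd b n ≡ q₁ * q₃ × gcd a n ≡ q₂ * q₃

-- one of (A2),(A3),(A4) holds for a suitable labeling of the primes
-- (the labeling may depend on which condition holds)
OneOfA : (p₁ p₂ p₃ n a b c : ℕ) → Set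
OneOfA p₁ p₂ p₃ n a b c =
  ∃[ q₁ ] ∃[ q₂ ] ∃[ q₃ ] (Relabel p₁ p₂ p₃ q₁ q₂ q₃ ×
    (CondA2 n a b c q₁ q₂ q₃ ⊎ CondA3 n a b c q₁ q₂ q₃ ⊎ CondA4 n a b c q₁ q₂ q₃))

-- the integer x lies in [ (2s-2t-1) n / (2b) , (s-t) n / b ]
-- (denominators cleared; b > 0 in all uses)
InI : (n b s t x : ℕ) → Set
InI n b s t x = (2 * s ∸ 2 * t ∸ 1) * n ≤ 2 * b * x × b * x ≤ (s ∸ t) * n

module Submission where

-- Proof idea.  Write I_t for the integer points of the interval
-- [(2s-2t-1)n/(2b), (s-t)n/b].  Two facts about n = p₁p₂p₃ and about
-- intervals of integers give the lemma.
--
--  * Every prime factor of n is at least 4 because gcd(n,6) = 1, so it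
--    divides at most one of four consecutive integers; as n has
--    only three prime factors, one of any four consecutive integers is
--    coprime to n (pigeonhole).
--  * Since I_t contains no integer coprime to n, it never contains both
--    m and m+3.  An interval of integers with this property has at most
--    three elements: all its elements lie in the window [m, m+3) above
--    its least element m, and k distinct naturals in a window of width k
--    number at most k (pigeonhole again).
--  * If n ≥ 8b, the interval I_0 has length n/(2b) ≥ 4, so it contains
--    two integers three apart, contradicting the previous point.

open import Defs
open import Data.Nat using (ℕ; _+_; _*_; _∸_; _≤_; _<_; NonZero)
open import Data.Nat.DivMod using (_/_)
open import Data.Nat.GCD using (gcd)
open import Data.Nat.Primality using (Prime)
open import Data.Nat.Coprimality using (Coprime)
open import Data.List using (List; length)
open import Data.List.Relation.Unary.All using (All)
open import Data.List.Relation.Unary.Unique.Propositional using (Unique)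
open import Data.Product using (_×_; ∃-syntax)
open import Relation.Nullary using (¬_)
open import Relation.Binary.PropositionalEquality using (_≡_; _≢_)

open import Data.Nat using (suc; z≤n; s≤s; s≤s⁻¹; _<?_; >-nonZero)
open import Data.Nat.Properties
open import Data.Nat.DivMod using (m≡m%n+[m/n]*n; m%n<n; m/n*n≤m; m/n≤m)
open import Data.Nat.Divisibility using (_∣_; _∣?_; divides; ∣-trans; ∣⇒≤; ∣1⇒≡1; ∣m+n∣m⇒∣n; m∣m*n; n∣m*n; n∣m*n*o)
open import Data.Nat.GCD using (gcd-greatest)
open import Data.Nat.Primality using (prime⇒irreducible; ¬prime[0]; ¬prime[1])
open import Data.Nat.Coprimality using (coprime-divisor)
open import Data.Fin using (Fin; toℕ; fromℕ<) renaming (zero to fz; suc to fs)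
open import Data.Fin.Properties using (pigeonhole; toℕ<n; toℕ-fromℕ<) renaming (<⇒≢ to <⇒≢ᶠ)
open import Data.List using ([]; _∷_; lookup)
open import Data.List.Relation.Unary.All using (_∷_)
import Data.List.Relation.Unary.All as All
open import Data.List.Relation.Unary.AllPairs using (_∷_)
open import Data.List.Membership.Propositional.Properties using (∈-lookup)
open import Data.List.Extrema.Nat using (min; argmin-all; min≤xs; min≤⊤)
open import Data.Product using (Σ; _,_; proj₁; proj₂)
open import Data.Sum using (inj₁; inj₂)
open import Data.Empty using (⊥; ⊥-elim)
open import Relation.Nullary using (yes; no; contradiction)
open import Relation.Binary.PropositionalEquality using (refl; sym; trans; cong; subst)
open import Data.Nat.Tactic.RingSolver using (solve-∀)

coprime-to-prime : ∀ {p x} → Prime p → ¬ p ∣ x → Coprime x p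
coprime-to-prime p-prime p∤x {d} (d∣x , d∣p) with prime⇒irreducible p-prime d∣p
... | inj₁ d≡1 = d≡1
... | inj₂ refl = contradiction d∣x p∤x

coprime-* : ∀ {x a b} → Coprime x a → Coprime x b → Coprime x (a * b)
coprime-* {a = a} x⊥a x⊥b {d} (d∣x , d∣ab) = x⊥b (d∣x , coprime-divisor d⊥a d∣ab)
  where
  d⊥a : Coprime d a
  d⊥a (e∣d , e∣a) = x⊥a (∣-trans e∣d d∣x , e∣a)

prime-factor≥4 : ∀ {p n} → Prime p → p ∣ n → gcd n 6 ≡ 1 → 4 ≤ p
prime-factor≥4 {0} p-prime _ _ = ⊥-elim (¬prime[0] p-prime)
prime-factor≥4 {1} p-prime _ _ = ⊥-elim (¬prime[1] p-prime)
prime-factor≥4 {2} _ 2∣n gcd≡1 =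
  contradiction (∣1⇒≡1 (subst (2 ∣_) gcd≡1 (gcd-greatest 2∣n (divides 3 refl)))) λ ()
prime-factor≥4 {3} _ 3∣n gcd≡1 =
  contradiction (∣1⇒≡1 (subst (3 ∣_) gcd≡1 (gcd-greatest 3∣n (divides 2 refl)))) λ ()
prime-factor≥4 {suc (suc (suc (suc _)))} _ _ _ = s≤s (s≤s (s≤s (s≤s z≤n)))

-- A number p ≥ 4 divides at most one of m, m+1, m+2, m+3: two
-- multiples of p in this range would differ by a positive number < p.
divides-one-of-four : ∀ {p} → 4 ≤ p → ∀ m j k → j < k → k ≤ 3 →
                      p ∣ m + j → p ∣ m + k → ⊥
divides-one-of-four {p} 4≤p m j k j<k k≤3 p∣m+j p∣m+k =
  contradiction (≤-trans 4≤p (≤-trans p≤k∸j (≤-trans (m∸n≤m k j) k≤3))) (n≮n 3)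
  where
  m+j+[k∸j]≡m+k : m + j + (k ∸ j) ≡ m + k
  m+j+[k∸j]≡m+k = trans (+-assoc m j (k ∸ j)) (cong (m +_) (m+[n∸m]≡n (<⇒≤ j<k)))
  p≤k∸j : p ≤ k ∸ j
  p≤k∸j = ∣⇒≤ {{>-nonZero (m<n⇒0<n∸m j<k)}}
            (∣m+n∣m⇒∣n (subst (p ∣_) (sym m+j+[k∸j]≡m+k) p∣m+k) p∣m+j)

module _ {p₁ p₂ p₃ : ℕ} (pr₁ : Prime p₁) (pr₂ : Prime p₂) (pr₃ : Prime p₃)
         (4≤p₁ : 4 ≤ p₁) (4≤p₂ : 4 ≤ p₂) (4≤p₃ : 4 ≤ p₃) where

  -- The three primes, indexed by Fin 3 so that pigeonhole applies.
  prime : Fin 3 → ℕ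
  prime fz = p₁
  prime (fs fz) = p₂
  prime (fs (fs fz)) = p₃

  prime≥4 : ∀ i → 4 ≤ prime i
  prime≥4 fz = 4≤p₁
  prime≥4 (fs fz) = 4≤p₂
  prime≥4 (fs (fs fz)) = 4≤p₃

  some-prime-divides : ∀ x → ¬ Coprime x (p₁ * p₂ * p₃) → Σ (Fin 3) λ i → prime i ∣ x
  some-prime-divides x not-coprime with p₁ ∣? x | p₂ ∣? x | p₃ ∣? x
  ... | yes p₁∣x | _ | _ = fz , p₁∣x
  ... | no _ | yes p₂∣x | _ = fs fz , p₂∣x
  ... | no _ | no _ | yes p₃∣x = fs (fs fz) , p₃∣x
  ... | no p₁∤x | no p₂∤x | no p₃∤x = ⊥-elim (not-coprime
        (coprime-* (coprime-* (coprime-to-prime pr₁ p₁∤x) (coprime-to-prime pr₂ p₂∤x))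
                   (coprime-to-prime pr₃ p₃∤x)))

  NoneCoprime : ℕ → Set
  NoneCoprime m = ∀ j → j ≤ 3 → ¬ Coprime (m + j) (p₁ * p₂ * p₃)

  chosen-divisor : ∀ {m} → NoneCoprime m → (j : Fin 4) → Σ (Fin 3) λ i → prime i ∣ m + toℕ j
  chosen-divisor {m} none j = some-prime-divides (m + toℕ j) (none (toℕ j) (s≤s⁻¹ (toℕ<n j)))

  -- Among four consecutive integers one is coprime to p₁p₂p₃: otherwise,
  -- by pigeonhole, the same p_i is chosen for two of them, contradicting
  -- divides-one-of-four.
  four-consecutive-coprime : ∀ m → ¬ NoneCoprime m
  four-consecutive-coprime m none
    with j , k , j<k , same-prime ← pigeonhole (n<1+n 3) (λ j → proj₁ (chosen-divisor none j)) =
    divides-one-of-four (prime≥4 (proj₁ (chosen-divisor none j))) m (toℕ j) (toℕ k) j<k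
      (s≤s⁻¹ (toℕ<n k)) (proj₂ (chosen-divisor none j))
      (subst (λ i → prime i ∣ m + toℕ k) (sym same-prime) (proj₂ (chosen-divisor none k)))

lookup-injective : ∀ {A : Set} {xs : List A} → Unique xs →
                   ∀ i j → lookup xs i ≡ lookup xs j → i ≡ j
lookup-injective (_ ∷ _) fz fz _ = refl
lookup-injective (x∉xs ∷ _) fz (fs j) x≡xsⱼ = contradiction x≡xsⱼ (All.lookup x∉xs (∈-lookup j))
lookup-injective (x∉xs ∷ _) (fs i) fz xsᵢ≡x = contradiction (sym xsᵢ≡x) (All.lookup x∉xs (∈-lookup i))
lookup-injective (_ ∷ unique) (fs i) (fs j) xsᵢ≡xsⱼ = cong fs (lookup-injective unique i j xsᵢ≡xsⱼ)

InWindow : ℕ → ℕ → ℕ → Set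
InWindow m k y = m ≤ y × y < m + k

offset : ∀ {m k xs} → All (InWindow m k) xs → Fin (length xs) → Fin k
offset {m} {k} {xs} in-window i = fromℕ< (subst (y ∸ m <_) (m+n∸m≡n m k) (∸-monoˡ-< y<m+k m≤y))
  where
  y = lookup xs i
  m≤y = proj₁ (All.lookup in-window (∈-lookup i))
  y<m+k = proj₂ (All.lookup in-window (∈-lookup i))

-- A duplicate-free list of naturals inside a window of width k has at
-- most k entries: by pigeonhole two entries would have the same offset.
distinct-in-window : ∀ {m k xs} → Unique xs → All (InWindow m k) xs → length xs ≤ k
distinct-in-window {m} {k} {xs} unique in-window with k <? length xs
... | no k≮len = ≮⇒≥ k≮len
... | yes k<len with i , j , i<j , same-offset ← pigeonhole k<len (offset in-window) =
  ⊥-elim (<⇒≢ᶠ i<j (lookup-injective unique i j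
    (∸-cancelʳ-≡ (m≤entry i) (m≤entry j)
      (trans (sym (toℕ-fromℕ< _)) (trans (cong toℕ same-offset) (toℕ-fromℕ< _))))))
  where
  m≤entry : ∀ i → m ≤ lookup xs i
  m≤entry i = proj₁ (All.lookup in-window (∈-lookup i))

IsInterval : (ℕ → Set) → Set
IsInterval In = ∀ {y z w} → In y → In z → y ≤ w → w ≤ z → In w

-- An interval containing no two points at distance k has at most k
-- points: all of them lie in the window of width k above the least one.
short-interval-size : ∀ {In k} → IsInterval In → (∀ m → In m → ¬ In (m + k)) →
                      ∀ xs → Unique xs → All In xs → length xs ≤ k
short-interval-size _ _ [] _ _ = z≤n
short-interval-size {In} {k} interval no-span (x ∷ xs) unique (in-x ∷ in-xs) =
  distinct-in-window unique (All.zip (min≤⊤ x xs ∷ min≤xs x xs , All.map below (in-x ∷ in-xs)))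
  where
  m = min x xs
  in-m : In m
  in-m = argmin-all (λ y → y) in-x in-xs
  below : ∀ {y} → In y → y < m + k
  below {y} in-y with y <? m + k
  ... | yes y<m+k = y<m+k
  ... | no y≮m+k = ⊥-elim (no-span m in-m (interval in-m in-y (m≤m+n m k) (≮⇒≥ y≮m+k)))

-- x lies in the rational interval [L/(2b), U/b], denominators cleared.
-- InI n b s t is the case L = (2s-2t-1)n, U = (s-t)n.
Between : ℕ → ℕ → ℕ → ℕ → Set
Between L U b x = L ≤ 2 * b * x × b * x ≤ U

between-interval : ∀ {L U b} → IsInterval (Between L U b)
between-interval {b = b} (L≤2by , _) (_ , bz≤U) y≤w w≤z =
  ≤-trans L≤2by (*-monoʳ-≤ (2 * b) y≤w) , ≤-trans (*-monoʳ-≤ b w≤z) bz≤U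

-- 2 (q + 1) b written in terms of y = q - 3.
double-successor : ∀ y b → 2 * (suc (y + 3) * b) ≡ 2 * b * y + 8 * b
double-successor = solve-∀

-- An interval [L/(2b), U/b] of length at least 4 contains two integers
-- three apart, namely y = ⌊U/b⌋ - 3 and y + 3.
wide-interval : ∀ L U b .{{_ : NonZero b}} → L + 8 * b ≤ 2 * U →
                ∃[ y ] Between L U b y × Between L U b (y + 3)
wide-interval L U b L+8b≤2U =
  y , (L≤2by , ≤-trans (*-monoʳ-≤ b (m≤m+n y 3)) b[y+3]≤U)
    , (≤-trans L≤2by (*-monoʳ-≤ (2 * b) (m≤m+n y 3)) , b[y+3]≤U)
  where
  q = U / b
  bq≤U : b * q ≤ U
  bq≤U = subst (_≤ U) (*-comm q b) (m/n*n≤m U b)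
  U<[q+1]b : U < suc q * b
  U<[q+1]b = subst (_< suc q * b) (sym (m≡m%n+[m/n]*n U b)) (+-monoˡ-< (q * b) (m%n<n U b))
  2U<2[q+1]b : 2 * U < 2 * (suc q * b)
  2U<2[q+1]b = *-monoʳ-< 2 U<[q+1]b
  3≤q : 3 ≤ q
  3≤q with 3 ≤? q
  ... | yes 3≤q = 3≤q
  ... | no 3≰q = ⊥-elim (<-irrefl refl (begin-strict
        2 * U               <⟨ 2U<2[q+1]b ⟩
        2 * (suc q * b)     ≤⟨ *-monoʳ-≤ 2 (*-monoˡ-≤ b (≰⇒> 3≰q)) ⟩
        2 * (3 * b)         ≤⟨ *-monoʳ-≤ 2 (*-monoˡ-≤ b (n≤1+n 3)) ⟩
        2 * (4 * b)         ≡⟨ sym (*-assoc 2 4 b) ⟩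
        8 * b               ≤⟨ m≤n+m (8 * b) L ⟩
        L + 8 * b           ≤⟨ L+8b≤2U ⟩
        2 * U               ∎))
    where open ≤-Reasoning
  y = q ∸ 3
  q≡y+3 : q ≡ y + 3
  q≡y+3 = sym (m∸n+n≡m 3≤q)
  b[y+3]≤U : b * (y + 3) ≤ U
  b[y+3]≤U = subst (λ z → b * z ≤ U) q≡y+3 bq≤U
  L≤2by : L ≤ 2 * b * y
  L≤2by = <⇒≤ (+-cancelʳ-< (8 * b) L (2 * b * y) (begin-strict
        L + 8 * b               ≤⟨ L+8b≤2U ⟩
        2 * U                   <⟨ 2U<2[q+1]b ⟩
        2 * (suc q * b)         ≡⟨ cong (λ z → 2 * (suc z * b)) q≡y+3 ⟩
        2 * (suc (y + 3) * b)   ≡⟨ double-successor y b ⟩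
        2 * b * y + 8 * b       ∎))
    where open ≤-Reasoning

-- For s ≥ 1 and n ≥ 8b the interval I_0 = [(2s-1)n/(2b), sn/b] has
-- length n/(2b) ≥ 4.
first-interval-wide : ∀ {n b s} → 1 ≤ s → 8 * b ≤ n → (2 * s ∸ 1) * n + 8 * b ≤ 2 * (s * n)
first-interval-wide {n} {b} {s} 1≤s 8b≤n = begin
  (2 * s ∸ 1) * n + 8 * b   ≡⟨ cong (_+ 8 * b) (*-distribʳ-∸ n (2 * s) 1) ⟩
  (2 * s * n ∸ 1 * n) + 8 * b ≡⟨ cong (λ m → 2 * s * n ∸ m + 8 * b) (*-identityˡ n) ⟩
  (2 * s * n ∸ n) + 8 * b   ≤⟨ +-monoʳ-≤ (2 * s * n ∸ n) 8b≤n ⟩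
  (2 * s * n ∸ n) + n       ≡⟨ m∸n+n≡m n≤2sn ⟩
  2 * s * n                 ≡⟨ *-assoc 2 s n ⟩
  2 * (s * n)               ∎
  where
  open ≤-Reasoning
  n≤2sn : n ≤ 2 * s * n
  n≤2sn = subst (_≤ 2 * s * n) (*-identityˡ n) (*-monoˡ-≤ n (≤-trans 1≤s (m≤m+n s (1 * s))))

-- Only the factorisation of n, gcd(n,6) = 1, 2 ≤ s = ⌊b/a⌋ and the
-- coprimality hypothesis on the intervals are needed.
lemma3p6 : (p₁ p₂ p₃ : ℕ) → Prime p₁ → Prime p₂ → Prime p₃ →
    p₁ ≢ p₂ → p₁ ≢ p₃ → p₂ ≢ p₃ →
    (n : ℕ) → .{{_ : NonZero n}} → n ≡ p₁ * p₂ * p₃ → gcd n 6 ≡ 1 → 1000 < n →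
    (g : ℕ) → HasOrder n g n →
    (a b c : ℕ) → .{{_ : NonZero a}} → 1 + c ≡ a + b →
    1 < c → 2 * c < n → n < 2 * (n ∸ b) → n ∸ b ≤ n ∸ a → n ∸ a < n ∸ 1 →
    IsMinimalZeroSum n (seqS n g a b c) → IsReduced n g a b c →
    OneOfA p₁ p₂ p₃ n a b c →
    2 ≤ b / a →
    (∀ t → t ≤ (b / a) / 2 ∸ 1 →
    ¬ (∃[ x ] (InI n b (b / a) t x × Coprime x n))) →
    (∀ t → t ≤ (b / a) / 2 ∸ 1 →
    ∀ (xs : List ℕ) → Unique xs → All (InI n b (b / a) t) xs → length xs ≤ 3)
    × n < 8 * b
lemma3p6 p₁ p₂ p₃ pr₁ pr₂ pr₃ _ _ _ n n≡p₁p₂p₃ gcd[n,6]≡1 _ _ _ a b _ _ _ _ _ _ _ _ _ _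
         2≤s no-coprime = at-most-three , n<8b
  where
  s = b / a

  b≢0 : NonZero b
  b≢0 = >-nonZero (≤-trans (s≤s z≤n) (≤-trans 2≤s (m/n≤m b a)))

  factor≥4 : ∀ {p} → Prime p → p ∣ p₁ * p₂ * p₃ → 4 ≤ p
  factor≥4 p-prime p∣n = prime-factor≥4 p-prime (subst (_ ∣_) (sym n≡p₁p₂p₃) p∣n) gcd[n,6]≡1

  -- I_t never contains m and m+3, as then it would contain all of
  -- m, …, m+3, one of which is coprime to n.
  no-span : ∀ t → t ≤ s / 2 ∸ 1 → ∀ m → InI n b s t m → ¬ InI n b s t (m + 3)
  no-span t t≤ m in-m in-m+3 =
    four-consecutive-coprime pr₁ pr₂ pr₃
      (factor≥4 pr₁ (∣-trans (m∣m*n p₂) (m∣m*n p₃)))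
      (factor≥4 pr₂ (n∣m*n*o p₁ p₃)) (factor≥4 pr₃ (n∣m*n (p₁ * p₂))) m
      λ j j≤3 m+j⊥n → no-coprime t t≤
        (m + j , between-interval {b = b} in-m in-m+3 (m≤m+n m j) (+-monoʳ-≤ m j≤3)
               , subst (Coprime (m + j)) (sym n≡p₁p₂p₃) m+j⊥n)

  at-most-three : ∀ t → t ≤ s / 2 ∸ 1 →
                  ∀ xs → Unique xs → All (InI n b s t) xs → length xs ≤ 3
  at-most-three t t≤ = short-interval-size (between-interval {b = b}) (no-span t t≤)

  -- If n ≥ 8b, I_0 is too wide to avoid containing two points three apart.
  n<8b : n < 8 * b
  n<8b with n <? 8 * b
  ... | yes n<8b = n<8b
  ... | no n≮8b with y , in-y , in-y+3 ←
          wide-interval ((2 * s ∸ 1) * n) (s * n) b {{b≢0}}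
            (first-interval-wide {b = b} (≤-trans (s≤s z≤n) 2≤s) (≮⇒≥ n≮8b)) =
    ⊥-elim (no-span 0 z≤n y in-y in-y+3)
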